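{- Let $r\in\{f,\beta\}$ and $U\in\mathbb U$. Then: (1) $[U]_r=\{M\in\mathcal M\mid M:\langle env^M_\omega\vdash U\rangle\}$; (2) $[U]_r$ is stable under $\beta$-reduction: if $M\in[U]_r$ and $M\rhd_\beta^* N$ then $N\in[U]_r$; (3) $[U]_r$ is stable under $\beta$-expansion: if $M\in[U]_r$ and $N\rhd_\beta^* M$ then $N\in[U]_r$; (4) $[U]_r=\{M\in\mathcal M\mid M\rhd_\beta^* N\text{ for some }N\text{ with }N:\langle env^N_\omega\vdash U\rangle\}$.
   Context: Terms: $\mathcal V$ is a denumerably infinite set of variables; $\mathcal M$ is the set of untyped $\lambda$-terms $M::=x\mid \lambda x.M\mid MM$ taken modulo $\alpha$-conversion; $FV(M)$ is the set of free variables; $M[x:=N]$ is capture-avoiding substitution. $\rhd_\beta$ is the compatible closure of $(\lambda x.M)N\rhd_\beta M[x:=N]$. Weak head reduction: $M\rhd_f N$ iff $M=(\lambda x.P)QQ_1\dots Q_n$ and $N=P[x:=Q]Q_1\dots Q_n$ for some $n\ge 0$. $\rhd_r^*$ is the reflexive-transitive closure of $\rhd_r$. Types: $\mathcal A$ is a denumerably infinite set of atomic types; $\mathbb T::=a\mid \mathbb U\to\mathbb T$ ($a\in\mathcal A$) and $\mathbb U::=\omega\mid \mathbb U\sqcap\mathbb U\mid \mathbb T$; types are quotiented by commutativity, associativity and idempotence of $\sqcap$ and by $\omega\sqcap U=U$. $T$ ranges over $\mathbb T$, $U,V$ over $\mathbb U$. Environments: a type environment is a finite set $(x_i:U_i)_n$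 of declarations with pairwise distinct variables; $dom$ is its set of variables; $\Gamma,x:U$ requires $x\notin dom(\Gamma)$; $env^M_\omega$ assigns $\omega$ to each variable of $FV(M)$ and nothing else; if $\Gamma_1=(x_i:U_i)_n,(y_j:V_j)_m$ and $\Gamma_2=(x_i:U'_i)_n,(z_k:W_k)_l$ with the $y_j$, $z_k$ all distinct, then $\Gamma_1\sqcap\Gamma_2=(x_i:U_i\sqcap U'_i)_n,(y_j:V_j)_m,(z_k:W_k)_l$. Subtyping: $\sqsubseteq$ (on types, on environments, and on typings $\langle\Gamma\vdash U\rangle$) is the least relation closed under: $\Phi\sqsubseteq\Phi$; transitivity; $U_1\sqcap U_2\sqsubseteq U_1$; if $U_1\sqsubseteq V_1$ and $U_2\sqsubseteq V_2$ then $U_1\sqcap U_2\sqsubseteq V_1\sqcap V_2$; if $U_2\sqsubseteq U_1$ and $T_1\sqsubseteq T_2$ then $U_1\to T_1\sqsubseteq U_2\to T_2$; if $U_1\sqsubseteq U_2$ and $x\notin dom(\Gamma)$ then $\Gamma,x:U_1\sqsubseteq\Gamma,x:U_2$; if $U_1\sqsubseteq U_2$ and $\Gamma_2\sqsubseteq\Gamma_1$ then $\langle\Gamma_1\vdash U_1\rangle\sqsubseteq\langle\Gamma_2\vdash U_2\rangle$. Typing rules for $M:\langle\Gamma\vdash U\rangle$: (ax) $x:\langle x:T\vdash T\rangle$ for $T\in\mathbb T$; ($\omega$) $M:\langle env^M_\omega\vdash\omega\rangle$; ($\to_i$) from $M:\langle\Gamma,x:U\vdash T\rangle$ infer $\lambda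 x.M:\langle\Gamma\vdash U\to T\rangle$; ($\to'_i$) from $M:\langle\Gamma\vdash T\rangle$ and $x\notin dom(\Gamma)$ infer $\lambda x.M:\langle\Gamma\vdash\omega\to T\rangle$; ($\to_e$) from $M_1:\langle\Gamma_1\vdash U\to T\rangle$ and $M_2:\langle\Gamma_2\vdash U\rangle$ infer $M_1M_2:\langle\Gamma_1\sqcap\Gamma_2\vdash T\rangle$; ($\sqcap_i$) from $M:\langle\Gamma\vdash U_1\rangle$ and $M:\langle\Gamma\vdash U_2\rangle$ infer $M:\langle\Gamma\vdash U_1\sqcap U_2\rangle$; ($\sqsubseteq$) from $M:\langle\Gamma\vdash U\rangle$ and $\langle\Gamma\vdash U\rangle\sqsubseteq\langle\Gamma'\vdash U'\rangle$ infer $M:\langle\Gamma'\vdash U'\rangle$. Semantics: for $\mathcal X,\mathcal Y\subseteq\mathcal M$, $\mathcal X\leadsto\mathcal Y=\{M\in\mathcal M\mid MN\in\mathcal Y\text{ for all }N\in\mathcal X\}$. For $r\in\{f,\beta\}$, $\mathcal X$ is $r$-saturated if $M\rhd_r^*N$ and $N\in\mathcal X$ imply $M\in\mathcal X$. An $r$-interpretation is a function $\mathcal I:\mathcal A\to\mathcal P(\mathcal M)$ with every $\mathcal I(a)$ $r$-saturated, extended to $\mathbb U$ by $\mathcal I(\omega)=\mathcal M$, $\mathcal I(U_1\sqcap U_2)=\mathcal I(U_1)\cap\mathcal I(U_2)$, $\mathcal I(U\to T)=\mathcal I(U)\leadsto\mathcal I(T)$. The meaning of $U$ is $[U]_r=\bigcap\{\mathcal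 I(U)\mid \mathcal I\text{ an }r\text{ -interpretation}\}$. -}

module Defs where

open import Data.Nat using (ℕ; zero; suc; _≡ᵇ_)
open import Data.Bool using (Bool; true; false; if_then_else_; _∨_)
open import Data.Maybe using (Maybe; just; nothing)
open import Data.Unit using (⊤)
open import Data.Product using (_×_)
open import Relation.Binary.Construct.Closure.ReflexiveTransitive using (Star)

-- Terms: untyped λ-terms with de Bruijn indices (this IS 𝓜 modulo α).
-- Variables 𝒱 are ℕ (denumerably infinite).

data Λ : Set where
  var : ℕ → Λ
  lam : Λ → Λ
  app : Λ → Λ → Λ

ext : (ℕ → ℕ) → ℕ → ℕ
ext ρ zero    = zero
ext ρ (suc i) = suc (ρ i)

rename : (ℕ → ℕ) → Λ → Λ
rename ρ (var i)   = var (ρ i)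
rename ρ (lam M)   = lam (rename (ext ρ) M)
rename ρ (app M N) = app (rename ρ M) (rename ρ N)

exts : (ℕ → Λ) → ℕ → Λ
exts σ zero    = var zero
exts σ (suc i) = rename suc (σ i)

subst : (ℕ → Λ) → Λ → Λ
subst σ (var i)   = σ i
subst σ (lam M)   = lam (subst (exts σ) M)
subst σ (app M N) = app (subst σ M) (subst σ N)

sub0 : Λ → ℕ → Λ
sub0 N zero    = N
sub0 N (suc i) = var i

_[_] : Λ → Λ → Λ
M [ N ] = subst (sub0 N) M

occurs : ℕ → Λ → Bool
occurs x (var y)   = x ≡ᵇ y
occurs x (lam M)   = occurs (suc x) M
occurs x (app M N) = occurs x M ∨ occurs x N

data _▷β_ : Λ → Λ → Set where
  β-rule : ∀ {M N} → app (lam M) N ▷β (M [ N ])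
  β-lam  : ∀ {M M'} → M ▷β M' → lam M ▷β lam M'
  β-appl : ∀ {M M' N} → M ▷β M' → app M N ▷β app M' N
  β-appr : ∀ {M N N'} → N ▷β N' → app M N ▷β app M N'

-- weak head: (λx.P)Q Q1…Qn ▷ P[x:=Q] Q1…Qn
data _▷f_ : Λ → Λ → Set where
  f-rule : ∀ {P Q} → app (lam P) Q ▷f (P [ Q ])
  f-appl : ∀ {M M' N} → M ▷f M' → app M N ▷f app M' N

data Red : Set where
  f β : Red

_▷[_]_ : Λ → Red → Λ → Set
M ▷[ f ] N = M ▷f N
M ▷[ β ] N = M ▷β N

_▷[_]*_ : Λ → Red → Λ → Set
M ▷[ r ]* N = Star (λ P Q → P ▷[ r ] Q) M N

_▷β*_ : Λ → Λ → Set
M ▷β* N = M ▷[ β ]* N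

infixr 7 _⇒_
infixl 8 _⊓_

mutual
  data 𝕋 : Set where
    atom : ℕ → 𝕋
    _⇒_  : 𝕌 → 𝕋 → 𝕋

  data 𝕌 : Set where
    ω   : 𝕌
    _⊓_ : 𝕌 → 𝕌 → 𝕌
    ⌜_⌝ : 𝕋 → 𝕌

-- The quotient: least congruence generated by commutativity,
-- associativity and idempotence of ⊓ and ω ⊓ U = U.
data _≈_ : 𝕌 → 𝕌 → Set where
  ≈-refl  : ∀ {U} → U ≈ U
  ≈-sym   : ∀ {U V} → U ≈ V → V ≈ U
  ≈-trans : ∀ {U V W} → U ≈ V → V ≈ W → U ≈ W
  ≈-comm  : ∀ {U V} → (U ⊓ V) ≈ (V ⊓ U)
  ≈-assoc : ∀ {U V W} → ((U ⊓ V) ⊓ W) ≈ (U ⊓ (V ⊓ W))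
  ≈-idem  : ∀ {U} → (U ⊓ U) ≈ U
  ≈-unit  : ∀ {U} → (ω ⊓ U) ≈ U
  ≈-⊓     : ∀ {U U' V V'} → U ≈ U' → V ≈ V' → (U ⊓ V) ≈ (U' ⊓ V')
  ≈-⇒     : ∀ {U U' T T'} → U ≈ U' → ⌜ T ⌝ ≈ ⌜ T' ⌝ → ⌜ U ⇒ T ⌝ ≈ ⌜ U' ⇒ T' ⌝

data _⊑_ : 𝕌 → 𝕌 → Set where
  ⊑-≈     : ∀ {U V} → U ≈ V → U ⊑ V
  ⊑-trans : ∀ {U V W} → U ⊑ V → V ⊑ W → U ⊑ W
  ⊑-⊓ˡ    : ∀ {U₁ U₂} → (U₁ ⊓ U₂) ⊑ U₁
  ⊑-⊓     : ∀ {U₁ U₂ V₁ V₂} → U₁ ⊑ V₁ → U₂ ⊑ V₂ → (U₁ ⊓ U₂) ⊑ (V₁ ⊓ V₂)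
  ⊑-⇒     : ∀ {U₁ U₂ T₁ T₂} → U₂ ⊑ U₁ → ⌜ T₁ ⌝ ⊑ ⌜ T₂ ⌝ → ⌜ U₁ ⇒ T₁ ⌝ ⊑ ⌜ U₂ ⇒ T₂ ⌝

-- Environments: partial maps from variables to 𝕌 (nothing = not in dom).

Env : Set
Env = ℕ → Maybe 𝕌

_∷ₑ_ : Maybe 𝕌 → Env → Env
(a ∷ₑ Γ) zero    = a
(a ∷ₑ Γ) (suc i) = Γ i

single : ℕ → 𝕌 → Env
single x U i = if i ≡ᵇ x then just U else nothing

envω : Λ → Env
envω M i = if occurs i M then just ω else nothing

_⊓ₘ_ : Maybe 𝕌 → Maybe 𝕌 → Maybe 𝕌
just U  ⊓ₘ just V  = just (U ⊓ V)
just U  ⊓ₘ nothing = just U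
nothing ⊓ₘ just V  = just V
nothing ⊓ₘ nothing = nothing

_⊓ₑ_ : Env → Env → Env
(Γ₁ ⊓ₑ Γ₂) i = Γ₁ i ⊓ₘ Γ₂ i

data _⊑ₘ_ : Maybe 𝕌 → Maybe 𝕌 → Set where
  none : nothing ⊑ₘ nothing
  some : ∀ {U V} → U ⊑ V → just U ⊑ₘ just V

_⊑ₑ_ : Env → Env → Set
Γ ⊑ₑ Δ = ∀ i → Γ i ⊑ₘ Δ i

data _∶⟨_⊢_⟩ : Λ → Env → 𝕌 → Set where
  ax   : ∀ {x T} → var x ∶⟨ single x ⌜ T ⌝ ⊢ ⌜ T ⌝ ⟩
  ω-r  : ∀ {M} → M ∶⟨ envω M ⊢ ω ⟩
  →i   : ∀ {M Γ U T} → M ∶⟨ just U ∷ₑ Γ ⊢ ⌜ T ⌝ ⟩ → lam M ∶⟨ Γ ⊢ ⌜ U ⇒ T ⌝ ⟩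
  →i'  : ∀ {M Γ T} → M ∶⟨ nothing ∷ₑ Γ ⊢ ⌜ T ⌝ ⟩ → lam M ∶⟨ Γ ⊢ ⌜ ω ⇒ T ⌝ ⟩
  →e   : ∀ {M₁ M₂ Γ₁ Γ₂ U T} → M₁ ∶⟨ Γ₁ ⊢ ⌜ U ⇒ T ⌝ ⟩ → M₂ ∶⟨ Γ₂ ⊢ U ⟩
         → app M₁ M₂ ∶⟨ Γ₁ ⊓ₑ Γ₂ ⊢ ⌜ T ⌝ ⟩
  ⊓i   : ∀ {M Γ U₁ U₂} → M ∶⟨ Γ ⊢ U₁ ⟩ → M ∶⟨ Γ ⊢ U₂ ⟩ → M ∶⟨ Γ ⊢ U₁ ⊓ U₂ ⟩
  ⊑r   : ∀ {M Γ U Γ' U'} → M ∶⟨ Γ ⊢ U ⟩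
         → U ⊑ U' → Γ' ⊑ₑ Γ
         → M ∶⟨ Γ' ⊢ U' ⟩

Pred𝓜 : Set₁
Pred𝓜 = Λ → Set

_⇝_ : Pred𝓜 → Pred𝓜 → Pred𝓜
(X ⇝ Y) M = ∀ N → X N → Y (app M N)

Saturated : Red → Pred𝓜 → Set
Saturated r X = ∀ M N → M ▷[ r ]* N → X N → X M

record Interp (r : Red) : Set₁ where
  field
    I   : ℕ → Pred𝓜
    sat : ∀ a → Saturated r (I a)

mutual
  ⟦_⟧𝕋 : ∀ {r} → 𝕋 → Interp r → Pred𝓜
  ⟦ atom a ⟧𝕋 𝓘 = Interp.I 𝓘 a
  ⟦ U ⇒ T ⟧𝕋 𝓘 = ⟦ U ⟧𝕌 𝓘 ⇝ ⟦ T ⟧𝕋 𝓘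

  ⟦_⟧𝕌 : ∀ {r} → 𝕌 → Interp r → Pred𝓜
  ⟦ ω ⟧𝕌 𝓘 M = ⊤
  ⟦ U₁ ⊓ U₂ ⟧𝕌 𝓘 M = ⟦ U₁ ⟧𝕌 𝓘 M × ⟦ U₂ ⟧𝕌 𝓘 M
  ⟦ ⌜ T ⌝ ⟧𝕌 𝓘 = ⟦ T ⟧𝕋 𝓘

[_]_ : 𝕌 → Red → Λ → Set₁
([ U ] r) M = (𝓘 : Interp r) → ⟦ U ⟧𝕌 𝓘 M

module Submission where

-- Official typing derivations are hard to invert (the
-- subsumption rule may occur anywhere and environments have varying
-- domains), so we pass through an equivalent syntax-directed system
-- "ρ ⊩ M ⦂ T" with total contexts ρ : ℕ → 𝕌 (undeclared variables get ω)
-- and with subtyping replaced by a syntax-directed preorder ≤ᵁ.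
--   1. Substitution algebra for de Bruijn terms.
--   2. The preorder ≤ᵁ, shown to coincide with ⊑.
--   3. Direct typing: transfer of contexts along free variables,
--      renaming, subsumption, substitution and inverse substitution,
--      hence subject reduction and subject expansion for β.
--   4. Soundness: a term typable in the all-ω context lies in ⟦U⟧ for
--      every r-interpretation (weak head expansion preserves ⟦T⟧).
--   5. Completeness: a term model interpreting atoms by direct typability
--      in a context that carries every domain type of U on some variable.
--   6. Translation between official and direct typing.
--   7. The theorem: by 4 and 5, [U]_r is exactly the set of terms directly
--      typable in the all-ω context; with 6 this is part (1), subject
--      reduction and expansion (3) give parts (2) and (3), and part (4)
--      follows from (1) and (3).

open import Defs
open import Data.Product using (_×_; ∃; ∃-syntax; _,_)
open import Function using (_∘_)
open import Function.Bundles using (_⇔_; mk⇔; Equivalence)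
open import Function.Construct.Composition using (_⇔-∘_)
open import Function.Construct.Symmetry using (⇔-sym)
open Equivalence using (to; from)
open import Data.Nat using (ℕ; zero; suc; _+_; _<_; _⊔_; pred; s≤s; _≡ᵇ_)
open import Data.Nat.Properties using (≡ᵇ⇒≡; ≡⇒≡ᵇ; m≤m⊔n; m≤n⊔m)
  renaming (≤-trans to ℕ-≤-trans; ≤-refl to ℕ-≤-refl)
open import Data.Unit using (⊤; tt)
open import Data.Bool using (true; false; if_then_else_)
open import Data.Maybe using (just; nothing; fromMaybe)
open import Data.List using (List; []; _∷_; _++_)
open import Data.List.Relation.Unary.Any using (here; there)
open import Data.List.Membership.Propositional using (_∈_)
open import Data.List.Membership.Propositional.Properties using (∈-++⁺ˡ; ∈-++⁺ʳ)
open import Relation.Binary.PropositionalEquality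
  using (_≡_; refl; cong; cong₂; sym; trans) renaming (subst to ≡subst)
open import Relation.Binary.Construct.Closure.ReflexiveTransitive using (ε; _◅_)

_∷ₛ_ : Λ → (ℕ → Λ) → ℕ → Λ
(N ∷ₛ σ) zero    = N
(N ∷ₛ σ) (suc i) = σ i

ext-cong : ∀ {φ ψ : ℕ → ℕ} → (∀ i → φ i ≡ ψ i) → ∀ i → ext φ i ≡ ext ψ i
ext-cong h zero    = refl
ext-cong h (suc i) = cong suc (h i)

rename-cong : ∀ {φ ψ} → (∀ i → φ i ≡ ψ i) → ∀ M → rename φ M ≡ rename ψ M
rename-cong h (var x)   = cong var (h x)
rename-cong h (lam M)   = cong lam (rename-cong (ext-cong h) M)
rename-cong h (app M N) = cong₂ app (rename-cong h M) (rename-cong h N)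

exts-cong : ∀ {σ τ : ℕ → Λ} → (∀ i → σ i ≡ τ i) → ∀ i → exts σ i ≡ exts τ i
exts-cong h zero    = refl
exts-cong h (suc i) = cong (rename suc) (h i)

subst-cong : ∀ {σ τ} → (∀ i → σ i ≡ τ i) → ∀ M → subst σ M ≡ subst τ M
subst-cong h (var x)   = h x
subst-cong h (lam M)   = cong lam (subst-cong (exts-cong h) M)
subst-cong h (app M N) = cong₂ app (subst-cong h M) (subst-cong h N)

ext-∘ : ∀ φ ψ i → ext ψ (ext φ i) ≡ ext (ψ ∘ φ) i
ext-∘ φ ψ zero    = refl
ext-∘ φ ψ (suc i) = refl

exts-ext : ∀ τ φ i → exts τ (ext φ i) ≡ exts (τ ∘ φ) i
exts-ext τ φ zero    = refl
exts-ext τ φ (suc i) = refl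

rename-rename : ∀ φ ψ M → rename ψ (rename φ M) ≡ rename (ψ ∘ φ) M
rename-rename φ ψ (var x)   = refl
rename-rename φ ψ (lam M)   =
  cong lam (trans (rename-rename (ext φ) (ext ψ) M) (rename-cong (ext-∘ φ ψ) M))
rename-rename φ ψ (app M N) = cong₂ app (rename-rename φ ψ M) (rename-rename φ ψ N)

subst-rename : ∀ τ φ M → subst τ (rename φ M) ≡ subst (τ ∘ φ) M
subst-rename τ φ (var x)   = refl
subst-rename τ φ (lam M)   =
  cong lam (trans (subst-rename (exts τ) (ext φ) M) (subst-cong (exts-ext τ φ) M))
subst-rename τ φ (app M N) = cong₂ app (subst-rename τ φ M) (subst-rename τ φ N)

rename-subst : ∀ φ σ M → rename φ (subst σ M) ≡ subst (rename φ ∘ σ) M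
rename-subst φ σ (var x)   = refl
rename-subst φ σ (lam M)   =
  cong lam (trans (rename-subst (ext φ) (exts σ) M) (subst-cong lift M))
  where
  lift : ∀ i → rename (ext φ) (exts σ i) ≡ exts (rename φ ∘ σ) i
  lift zero    = refl
  lift (suc i) = trans (rename-rename suc (ext φ) (σ i)) (sym (rename-rename φ suc (σ i)))
rename-subst φ σ (app M N) = cong₂ app (rename-subst φ σ M) (rename-subst φ σ N)

subst-subst : ∀ τ σ M → subst τ (subst σ M) ≡ subst (subst τ ∘ σ) M
subst-subst τ σ (var x)   = refl
subst-subst τ σ (lam M)   =
  cong lam (trans (subst-subst (exts τ) (exts σ) M) (subst-cong lift M))
  where
  lift : ∀ i → subst (exts τ) (exts σ i) ≡ exts (subst τ ∘ σ) i
  lift zero    = refl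
  lift (suc i) = trans (subst-rename (exts τ) suc (σ i)) (sym (rename-subst suc τ (σ i)))
subst-subst τ σ (app M N) = cong₂ app (subst-subst τ σ M) (subst-subst τ σ N)

subst-id : ∀ M → subst var M ≡ M
subst-id (var x)   = refl
subst-id (lam M)   = cong lam (trans (subst-cong exts-var M) (subst-id M))
  where
  exts-var : ∀ i → exts var i ≡ var i
  exts-var zero    = refl
  exts-var (suc i) = refl
subst-id (app M N) = cong₂ app (subst-id M) (subst-id N)

subst-exts-[] : ∀ σ N M → (subst (exts σ) M) [ N ] ≡ subst (N ∷ₛ σ) M
subst-exts-[] σ N M = trans (subst-subst (sub0 N) (exts σ) M) (subst-cong contract M)
  where
  contract : ∀ i → subst (sub0 N) (exts σ i) ≡ (N ∷ₛ σ) i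
  contract zero    = refl
  contract (suc i) = trans (subst-rename (sub0 N) suc (σ i)) (subst-id (σ i))

infix 4 _≤ᵁ_ _≤ᶜ_ _≤ᵀ_

mutual
  -- U ≤ᵁ V : every strict component of V lies above some component of U.
  data _≤ᵁ_ : 𝕌 → 𝕌 → Set where
    ≤ω  : ∀ {U} → U ≤ᵁ ω
    ≤⊓  : ∀ {U V W} → U ≤ᵁ V → U ≤ᵁ W → U ≤ᵁ V ⊓ W
    ≤⌜⌝ : ∀ {U T} → U ≤ᶜ T → U ≤ᵁ ⌜ T ⌝

  data _≤ᶜ_ : 𝕌 → 𝕋 → Set where
    ≤ᶜˡ  : ∀ {U V T} → U ≤ᶜ T → U ⊓ V ≤ᶜ T
    ≤ᶜʳ  : ∀ {U V T} → V ≤ᶜ T → U ⊓ V ≤ᶜ T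
    ≤ᶜ⌜⌝ : ∀ {T T'} → T ≤ᵀ T' → ⌜ T ⌝ ≤ᶜ T'

  data _≤ᵀ_ : 𝕋 → 𝕋 → Set where
    ≤atom : ∀ {a} → atom a ≤ᵀ atom a
    ≤⇒    : ∀ {U U' T T'} → U' ≤ᵁ U → T ≤ᵀ T' → U ⇒ T ≤ᵀ U' ⇒ T'

≤ᵁ-⊓ˡ : ∀ {U V W} → U ≤ᵁ W → U ⊓ V ≤ᵁ W
≤ᵁ-⊓ˡ ≤ω       = ≤ω
≤ᵁ-⊓ˡ (≤⊓ p q) = ≤⊓ (≤ᵁ-⊓ˡ p) (≤ᵁ-⊓ˡ q)
≤ᵁ-⊓ˡ (≤⌜⌝ p)  = ≤⌜⌝ (≤ᶜˡ p)

≤ᵁ-⊓ʳ : ∀ {U V W} → V ≤ᵁ W → U ⊓ V ≤ᵁ W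
≤ᵁ-⊓ʳ ≤ω       = ≤ω
≤ᵁ-⊓ʳ (≤⊓ p q) = ≤⊓ (≤ᵁ-⊓ʳ p) (≤ᵁ-⊓ʳ q)
≤ᵁ-⊓ʳ (≤⌜⌝ p)  = ≤⌜⌝ (≤ᶜʳ p)

mutual
  ≤ᵁ-refl : ∀ U → U ≤ᵁ U
  ≤ᵁ-refl ω       = ≤ω
  ≤ᵁ-refl (U ⊓ V) = ≤⊓ (≤ᵁ-⊓ˡ (≤ᵁ-refl U)) (≤ᵁ-⊓ʳ (≤ᵁ-refl V))
  ≤ᵁ-refl ⌜ T ⌝   = ≤⌜⌝ (≤ᶜ⌜⌝ (≤ᵀ-refl T))

  ≤ᵀ-refl : ∀ T → T ≤ᵀ T
  ≤ᵀ-refl (atom a) = ≤atom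
  ≤ᵀ-refl (U ⇒ T)  = ≤⇒ (≤ᵁ-refl U) (≤ᵀ-refl T)

mutual
  ≤ᵁ-trans : ∀ {U V W} → U ≤ᵁ V → V ≤ᵁ W → U ≤ᵁ W
  ≤ᵁ-trans p ≤ω       = ≤ω
  ≤ᵁ-trans p (≤⊓ q r) = ≤⊓ (≤ᵁ-trans p q) (≤ᵁ-trans p r)
  ≤ᵁ-trans p (≤⌜⌝ q)  = ≤⌜⌝ (≤ᵁ-≤ᶜ-trans p q)

  ≤ᵁ-≤ᶜ-trans : ∀ {U V T} → U ≤ᵁ V → V ≤ᶜ T → U ≤ᶜ T
  ≤ᵁ-≤ᶜ-trans (≤⊓ p _) (≤ᶜˡ q)  = ≤ᵁ-≤ᶜ-trans p q
  ≤ᵁ-≤ᶜ-trans (≤⊓ _ p) (≤ᶜʳ q)  = ≤ᵁ-≤ᶜ-trans p q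
  ≤ᵁ-≤ᶜ-trans (≤⌜⌝ p)  (≤ᶜ⌜⌝ t) = ≤ᶜ-≤ᵀ-trans p t

  ≤ᶜ-≤ᵀ-trans : ∀ {U T T'} → U ≤ᶜ T → T ≤ᵀ T' → U ≤ᶜ T'
  ≤ᶜ-≤ᵀ-trans (≤ᶜˡ p)  t = ≤ᶜˡ (≤ᶜ-≤ᵀ-trans p t)
  ≤ᶜ-≤ᵀ-trans (≤ᶜʳ p)  t = ≤ᶜʳ (≤ᶜ-≤ᵀ-trans p t)
  ≤ᶜ-≤ᵀ-trans (≤ᶜ⌜⌝ s) t = ≤ᶜ⌜⌝ (≤ᵀ-trans s t)

  ≤ᵀ-trans : ∀ {T₁ T₂ T₃} → T₁ ≤ᵀ T₂ → T₂ ≤ᵀ T₃ → T₁ ≤ᵀ T₃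
  ≤ᵀ-trans ≤atom     ≤atom     = ≤atom
  ≤ᵀ-trans (≤⇒ p s) (≤⇒ q t) = ≤⇒ (≤ᵁ-trans q p) (≤ᵀ-trans s t)

⊓-mono-≤ᵁ : ∀ {U U' V V'} → U ≤ᵁ U' → V ≤ᵁ V' → U ⊓ V ≤ᵁ U' ⊓ V'
⊓-mono-≤ᵁ p q = ≤⊓ (≤ᵁ-⊓ˡ p) (≤ᵁ-⊓ʳ q)

≡⇒≤ᵁ : ∀ {U V} → U ≡ V → U ≤ᵁ V
≡⇒≤ᵁ {U} refl = ≤ᵁ-refl U

⌜⌝-≤ᵁ-inv : ∀ {T T'} → ⌜ T ⌝ ≤ᵁ ⌜ T' ⌝ → T ≤ᵀ T'
⌜⌝-≤ᵁ-inv (≤⌜⌝ (≤ᶜ⌜⌝ t)) = t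

mutual
  ≈⇒≤ᵁ : ∀ {U V} → U ≈ V → U ≤ᵁ V
  ≈⇒≤ᵁ {U} ≈-refl           = ≤ᵁ-refl U
  ≈⇒≤ᵁ (≈-sym p)            = ≈⇒≥ᵁ p
  ≈⇒≤ᵁ (≈-trans p q)        = ≤ᵁ-trans (≈⇒≤ᵁ p) (≈⇒≤ᵁ q)
  ≈⇒≤ᵁ {U ⊓ V} ≈-comm       = ≤⊓ (≤ᵁ-⊓ʳ (≤ᵁ-refl V)) (≤ᵁ-⊓ˡ (≤ᵁ-refl U))
  ≈⇒≤ᵁ {U ⊓ V ⊓ W} ≈-assoc  =
    ≤⊓ (≤ᵁ-⊓ˡ (≤ᵁ-⊓ˡ (≤ᵁ-refl U))) (⊓-mono-≤ᵁ (≤ᵁ-⊓ʳ (≤ᵁ-refl V)) (≤ᵁ-refl W))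
  ≈⇒≤ᵁ {U ⊓ _} ≈-idem       = ≤ᵁ-⊓ˡ (≤ᵁ-refl U)
  ≈⇒≤ᵁ {_ ⊓ U} ≈-unit       = ≤ᵁ-⊓ʳ (≤ᵁ-refl U)
  ≈⇒≤ᵁ (≈-⊓ p q)            = ⊓-mono-≤ᵁ (≈⇒≤ᵁ p) (≈⇒≤ᵁ q)
  ≈⇒≤ᵁ (≈-⇒ p q)            = ≤⌜⌝ (≤ᶜ⌜⌝ (≤⇒ (≈⇒≥ᵁ p) (⌜⌝-≤ᵁ-inv (≈⇒≤ᵁ q))))

  ≈⇒≥ᵁ : ∀ {U V} → U ≈ V → V ≤ᵁ U
  ≈⇒≥ᵁ {U} ≈-refl           = ≤ᵁ-refl U
  ≈⇒≥ᵁ (≈-sym p)            = ≈⇒≤ᵁ p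
  ≈⇒≥ᵁ (≈-trans p q)        = ≤ᵁ-trans (≈⇒≥ᵁ q) (≈⇒≥ᵁ p)
  ≈⇒≥ᵁ {U ⊓ V} ≈-comm       = ≤⊓ (≤ᵁ-⊓ʳ (≤ᵁ-refl U)) (≤ᵁ-⊓ˡ (≤ᵁ-refl V))
  ≈⇒≥ᵁ {U ⊓ V ⊓ W} ≈-assoc  =
    ≤⊓ (⊓-mono-≤ᵁ (≤ᵁ-refl U) (≤ᵁ-⊓ˡ (≤ᵁ-refl V))) (≤ᵁ-⊓ʳ (≤ᵁ-⊓ʳ (≤ᵁ-refl W)))
  ≈⇒≥ᵁ {U ⊓ _} ≈-idem       = ≤⊓ (≤ᵁ-refl U) (≤ᵁ-refl U)
  ≈⇒≥ᵁ {_ ⊓ U} ≈-unit       = ≤⊓ ≤ω (≤ᵁ-refl U)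
  ≈⇒≥ᵁ (≈-⊓ p q)            = ⊓-mono-≤ᵁ (≈⇒≥ᵁ p) (≈⇒≥ᵁ q)
  ≈⇒≥ᵁ (≈-⇒ p q)            = ≤⌜⌝ (≤ᶜ⌜⌝ (≤⇒ (≈⇒≤ᵁ p) (⌜⌝-≤ᵁ-inv (≈⇒≥ᵁ q))))

⊑⇒≤ᵁ : ∀ {U V} → U ⊑ V → U ≤ᵁ V
⊑⇒≤ᵁ (⊑-≈ p)       = ≈⇒≤ᵁ p
⊑⇒≤ᵁ (⊑-trans p q) = ≤ᵁ-trans (⊑⇒≤ᵁ p) (⊑⇒≤ᵁ q)
⊑⇒≤ᵁ {U ⊓ _} ⊑-⊓ˡ  = ≤ᵁ-⊓ˡ (≤ᵁ-refl U)
⊑⇒≤ᵁ (⊑-⊓ p q)     = ⊓-mono-≤ᵁ (⊑⇒≤ᵁ p) (⊑⇒≤ᵁ q)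
⊑⇒≤ᵁ (⊑-⇒ p q)     = ≤⌜⌝ (≤ᶜ⌜⌝ (≤⇒ (⊑⇒≤ᵁ p) (⌜⌝-≤ᵁ-inv (⊑⇒≤ᵁ q))))

⊑-refl : ∀ {U} → U ⊑ U
⊑-refl = ⊑-≈ ≈-refl

⊑-ω : ∀ {U} → U ⊑ ω
⊑-ω = ⊑-trans (⊑-≈ (≈-sym ≈-unit)) ⊑-⊓ˡ

⊑-⊓ʳ : ∀ {U V} → (U ⊓ V) ⊑ V
⊑-⊓ʳ = ⊑-trans (⊑-≈ ≈-comm) ⊑-⊓ˡ

mutual
  ≤ᵁ⇒⊑ : ∀ {U V} → U ≤ᵁ V → U ⊑ V
  ≤ᵁ⇒⊑ ≤ω       = ⊑-ω
  ≤ᵁ⇒⊑ (≤⊓ p q) = ⊑-trans (⊑-≈ (≈-sym ≈-idem)) (⊑-⊓ (≤ᵁ⇒⊑ p) (≤ᵁ⇒⊑ q))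
  ≤ᵁ⇒⊑ (≤⌜⌝ p)  = ≤ᶜ⇒⊑ p

  ≤ᶜ⇒⊑ : ∀ {U T} → U ≤ᶜ T → U ⊑ ⌜ T ⌝
  ≤ᶜ⇒⊑ (≤ᶜˡ p)  = ⊑-trans ⊑-⊓ˡ (≤ᶜ⇒⊑ p)
  ≤ᶜ⇒⊑ (≤ᶜʳ p)  = ⊑-trans ⊑-⊓ʳ (≤ᶜ⇒⊑ p)
  ≤ᶜ⇒⊑ (≤ᶜ⌜⌝ t) = ≤ᵀ⇒⊑ t

  ≤ᵀ⇒⊑ : ∀ {T T'} → T ≤ᵀ T' → ⌜ T ⌝ ⊑ ⌜ T' ⌝
  ≤ᵀ⇒⊑ ≤atom    = ⊑-refl
  ≤ᵀ⇒⊑ (≤⇒ p t) = ⊑-⇒ (≤ᵁ⇒⊑ p) (≤ᵀ⇒⊑ t)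

-- A total context; variables not in the domain of an environment get ω.
Ctx : Set
Ctx = ℕ → 𝕌

_∷ᶜ_ : 𝕌 → Ctx → Ctx
(U ∷ᶜ ρ) zero    = U
(U ∷ᶜ ρ) (suc i) = ρ i

ω-ctx : Ctx
ω-ctx _ = ω

totalize : Env → Ctx
totalize Γ i = fromMaybe ω (Γ i)

_⊓ᶜ_ : Ctx → Ctx → Ctx
(ρ ⊓ᶜ ρ') i = ρ i ⊓ ρ' i

_≤ᶜᵗˣ_ : Ctx → Ctx → Set
ρ' ≤ᶜᵗˣ ρ = ∀ i → ρ' i ≤ᵁ ρ i

infix 4 _⊩_⦂_ _⊩_⦂ᵁ_

-- ρ ⊩ M ⦂ T: strict typing where subsumption only happens at variables;
-- ρ ⊩ M ⦂ᵁ U: M has every strict component of U.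
mutual
  data _⊩_⦂_ : Ctx → Λ → 𝕋 → Set where
    ⊩var : ∀ {ρ x T} → ρ x ≤ᶜ T → ρ ⊩ var x ⦂ T
    ⊩lam : ∀ {ρ M U T} → U ∷ᶜ ρ ⊩ M ⦂ T → ρ ⊩ lam M ⦂ U ⇒ T
    ⊩app : ∀ {ρ M N U T} → ρ ⊩ M ⦂ U ⇒ T → ρ ⊩ N ⦂ᵁ U → ρ ⊩ app M N ⦂ T

  data _⊩_⦂ᵁ_ : Ctx → Λ → 𝕌 → Set where
    ⊩ω   : ∀ {ρ M} → ρ ⊩ M ⦂ᵁ ω
    ⊩⊓   : ∀ {ρ M U V} → ρ ⊩ M ⦂ᵁ U → ρ ⊩ M ⦂ᵁ V → ρ ⊩ M ⦂ᵁ U ⊓ V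
    ⊩⌜⌝  : ∀ {ρ M T} → ρ ⊩ M ⦂ T → ρ ⊩ M ⦂ᵁ ⌜ T ⌝

⊩⌜⌝-inv : ∀ {ρ M T} → ρ ⊩ M ⦂ᵁ ⌜ T ⌝ → ρ ⊩ M ⦂ T
⊩⌜⌝-inv (⊩⌜⌝ d) = d

-- Every free variable of M is below fvBound M.
fvBound : Λ → ℕ
fvBound (var x)   = suc x
fvBound (lam M)   = pred (fvBound M)
fvBound (app M N) = fvBound M ⊔ fvBound N

mutual
  transfer : ∀ {ρ ρ' M T} → (∀ i → i < fvBound M → ρ' i ≤ᵁ ρ i)
           → ρ ⊩ M ⦂ T → ρ' ⊩ M ⦂ T
  transfer h (⊩var {x = x} p) = ⊩var (≤ᵁ-≤ᶜ-trans (h x ℕ-≤-refl) p)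
  transfer {ρ} {ρ'} h (⊩lam {M = M} {U = U} d) = ⊩lam (transfer h' d)
    where
    h' : ∀ i → i < fvBound M → (U ∷ᶜ ρ') i ≤ᵁ (U ∷ᶜ ρ) i
    h' zero    _ = ≤ᵁ-refl U
    h' (suc i) p = h i (pred-< p)
      where
      pred-< : ∀ {j n} → suc j < n → j < pred n
      pred-< {n = suc n} (s≤s q) = q
  transfer h (⊩app {M = M} {N = N} d e) =
    ⊩app (transfer (λ i p → h i (ℕ-≤-trans p (m≤m⊔n (fvBound M) (fvBound N)))) d)
         (transferᵁ (λ i p → h i (ℕ-≤-trans p (m≤n⊔m (fvBound M) (fvBound N)))) e)

  transferᵁ : ∀ {ρ ρ' M U} → (∀ i → i < fvBound M → ρ' i ≤ᵁ ρ i)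
            → ρ ⊩ M ⦂ᵁ U → ρ' ⊩ M ⦂ᵁ U
  transferᵁ h ⊩ω        = ⊩ω
  transferᵁ h (⊩⊓ a b)  = ⊩⊓ (transferᵁ h a) (transferᵁ h b)
  transferᵁ h (⊩⌜⌝ d)   = ⊩⌜⌝ (transfer h d)

narrow : ∀ {ρ ρ' M T} → ρ' ≤ᶜᵗˣ ρ → ρ ⊩ M ⦂ T → ρ' ⊩ M ⦂ T
narrow h = transfer (λ i _ → h i)

narrowᵁ : ∀ {ρ ρ' M U} → ρ' ≤ᶜᵗˣ ρ → ρ ⊩ M ⦂ᵁ U → ρ' ⊩ M ⦂ᵁ U
narrowᵁ h = transferᵁ (λ i _ → h i)

⊓ᶜ-≤ˡ : ∀ ρ ρ' → (ρ ⊓ᶜ ρ') ≤ᶜᵗˣ ρ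
⊓ᶜ-≤ˡ ρ ρ' i = ≤ᵁ-⊓ˡ (≤ᵁ-refl (ρ i))

⊓ᶜ-≤ʳ : ∀ ρ ρ' → (ρ ⊓ᶜ ρ') ≤ᶜᵗˣ ρ'
⊓ᶜ-≤ʳ ρ ρ' i = ≤ᵁ-⊓ʳ (≤ᵁ-refl (ρ' i))

mutual
  rename-⊩ : ∀ {ρ ρ' M T} (φ : ℕ → ℕ) → (∀ i → ρ' (φ i) ≤ᵁ ρ i)
           → ρ ⊩ M ⦂ T → ρ' ⊩ rename φ M ⦂ T
  rename-⊩ φ h (⊩var p) = ⊩var (≤ᵁ-≤ᶜ-trans (h _) p)
  rename-⊩ {ρ} {ρ'} φ h (⊩lam {U = U} d) = ⊩lam (rename-⊩ (ext φ) h' d)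
    where
    h' : ∀ i → (U ∷ᶜ ρ') (ext φ i) ≤ᵁ (U ∷ᶜ ρ) i
    h' zero    = ≤ᵁ-refl U
    h' (suc i) = h i
  rename-⊩ φ h (⊩app d e) = ⊩app (rename-⊩ φ h d) (rename-⊩ᵁ φ h e)

  rename-⊩ᵁ : ∀ {ρ ρ' M U} (φ : ℕ → ℕ) → (∀ i → ρ' (φ i) ≤ᵁ ρ i)
            → ρ ⊩ M ⦂ᵁ U → ρ' ⊩ rename φ M ⦂ᵁ U
  rename-⊩ᵁ φ h ⊩ω       = ⊩ω
  rename-⊩ᵁ φ h (⊩⊓ a b) = ⊩⊓ (rename-⊩ᵁ φ h a) (rename-⊩ᵁ φ h b)
  rename-⊩ᵁ φ h (⊩⌜⌝ d)  = ⊩⌜⌝ (rename-⊩ φ h d)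

mutual
  rename-⊩-inv : ∀ {ρ ρ' T} (φ : ℕ → ℕ) M → (∀ i → ρ i ≤ᵁ ρ' (φ i))
               → ρ' ⊩ rename φ M ⦂ T → ρ ⊩ M ⦂ T
  rename-⊩-inv φ (var x) h (⊩var p) = ⊩var (≤ᵁ-≤ᶜ-trans (h x) p)
  rename-⊩-inv {ρ} {ρ'} φ (lam M) h (⊩lam {U = U} d) = ⊩lam (rename-⊩-inv (ext φ) M h' d)
    where
    h' : ∀ i → (U ∷ᶜ ρ) i ≤ᵁ (U ∷ᶜ ρ') (ext φ i)
    h' zero    = ≤ᵁ-refl U
    h' (suc i) = h i
  rename-⊩-inv φ (app M N) h (⊩app d e) = ⊩app (rename-⊩-inv φ M h d) (rename-⊩ᵁ-inv φ N h e)

  rename-⊩ᵁ-inv : ∀ {ρ ρ' U} (φ : ℕ → ℕ) M → (∀ i → ρ i ≤ᵁ ρ' (φ i))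
                → ρ' ⊩ rename φ M ⦂ᵁ U → ρ ⊩ M ⦂ᵁ U
  rename-⊩ᵁ-inv φ M h ⊩ω       = ⊩ω
  rename-⊩ᵁ-inv φ M h (⊩⊓ a b) = ⊩⊓ (rename-⊩ᵁ-inv φ M h a) (rename-⊩ᵁ-inv φ M h b)
  rename-⊩ᵁ-inv φ M h (⊩⌜⌝ d)  = ⊩⌜⌝ (rename-⊩-inv φ M h d)

subsume : ∀ {ρ M T T'} → ρ ⊩ M ⦂ T → T ≤ᵀ T' → ρ ⊩ M ⦂ T'
subsume (⊩var p) t = ⊩var (≤ᶜ-≤ᵀ-trans p t)
subsume {ρ} (⊩lam {U = U} d) (≤⇒ {U' = U'} p t) = ⊩lam (subsume (narrow h d) t)
  where
  h : (U' ∷ᶜ ρ) ≤ᶜᵗˣ (U ∷ᶜ ρ)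
  h zero    = p
  h (suc i) = ≤ᵁ-refl (ρ i)
subsume (⊩app {U = U} d e) t = ⊩app (subsume d (≤⇒ (≤ᵁ-refl U) t)) e

subsumeᶜ : ∀ {ρ M U T} → ρ ⊩ M ⦂ᵁ U → U ≤ᶜ T → ρ ⊩ M ⦂ T
subsumeᶜ (⊩⊓ a _) (≤ᶜˡ p)  = subsumeᶜ a p
subsumeᶜ (⊩⊓ _ b) (≤ᶜʳ p)  = subsumeᶜ b p
subsumeᶜ (⊩⌜⌝ d)  (≤ᶜ⌜⌝ t) = subsume d t

subsumeᵁ : ∀ {ρ M U V} → ρ ⊩ M ⦂ᵁ U → U ≤ᵁ V → ρ ⊩ M ⦂ᵁ V
subsumeᵁ a ≤ω       = ⊩ω
subsumeᵁ a (≤⊓ p q) = ⊩⊓ (subsumeᵁ a p) (subsumeᵁ a q)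
subsumeᵁ a (≤⌜⌝ p)  = ⊩⌜⌝ (subsumeᶜ a p)

var-⊩ᵁ : ∀ {ρ x V} → ρ x ≤ᵁ V → ρ ⊩ var x ⦂ᵁ V
var-⊩ᵁ ≤ω       = ⊩ω
var-⊩ᵁ (≤⊓ p q) = ⊩⊓ (var-⊩ᵁ p) (var-⊩ᵁ q)
var-⊩ᵁ (≤⌜⌝ p)  = ⊩⌜⌝ (⊩var p)

var-⊩ᵁ-inv : ∀ {ρ x V} → ρ ⊩ var x ⦂ᵁ V → ρ x ≤ᵁ V
var-⊩ᵁ-inv ⊩ω              = ≤ω
var-⊩ᵁ-inv (⊩⊓ a b)        = ≤⊓ (var-⊩ᵁ-inv a) (var-⊩ᵁ-inv b)
var-⊩ᵁ-inv (⊩⌜⌝ (⊩var p))  = ≤⌜⌝ p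

-- If M applied to a variable declared with (at most) U has type T, then M
-- has type U ⇒ T; this is how the term model reads back functions.
app-var-inv : ∀ {ρ M x U T} → U ≤ᵁ ρ x → ρ ⊩ app M (var x) ⦂ T → ρ ⊩ M ⦂ U ⇒ T
app-var-inv {T = T} U≤x (⊩app d e) = subsume d (≤⇒ (≤ᵁ-trans U≤x (var-⊩ᵁ-inv e)) (≤ᵀ-refl T))

_⊩ₛ_⦂_ : Ctx → (ℕ → Λ) → Ctx → Set
ρ' ⊩ₛ σ ⦂ ρ = ∀ i → ρ' ⊩ σ i ⦂ᵁ ρ i

mutual
  subst-⊩ : ∀ {ρ ρ' M T} (σ : ℕ → Λ) → ρ' ⊩ₛ σ ⦂ ρ → ρ ⊩ M ⦂ T → ρ' ⊩ subst σ M ⦂ T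
  subst-⊩ σ h (⊩var p) = subsumeᶜ (h _) p
  subst-⊩ {ρ} {ρ'} σ h (⊩lam {U = U} d) = ⊩lam (subst-⊩ (exts σ) h' d)
    where
    h' : (U ∷ᶜ ρ') ⊩ₛ exts σ ⦂ (U ∷ᶜ ρ)
    h' zero    = var-⊩ᵁ (≤ᵁ-refl U)
    h' (suc i) = rename-⊩ᵁ suc (λ j → ≤ᵁ-refl (ρ' j)) (h i)
  subst-⊩ σ h (⊩app d e) = ⊩app (subst-⊩ σ h d) (subst-⊩ᵁ σ h e)

  subst-⊩ᵁ : ∀ {ρ ρ' M U} (σ : ℕ → Λ) → ρ' ⊩ₛ σ ⦂ ρ → ρ ⊩ M ⦂ᵁ U → ρ' ⊩ subst σ M ⦂ᵁ U
  subst-⊩ᵁ σ h ⊩ω       = ⊩ω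
  subst-⊩ᵁ σ h (⊩⊓ a b) = ⊩⊓ (subst-⊩ᵁ σ h a) (subst-⊩ᵁ σ h b)
  subst-⊩ᵁ σ h (⊩⌜⌝ d)  = ⊩⌜⌝ (subst-⊩ σ h d)

point : ℕ → 𝕌 → Ctx
point x V = totalize (single x V)

point-self : ∀ x V → point x V x ≡ V
point-self x V with x ≡ᵇ x | ≡⇒≡ᵇ x x refl
... | true | _ = refl

point-elim : ∀ x V (P : ℕ → 𝕌 → Set) → P x V → (∀ j → P j ω) → ∀ i → P i (point x V i)
point-elim x V P px pω i with i ≡ᵇ x | ≡ᵇ⇒≡ i x
... | true  | i≡x = ≡subst (λ j → P j V) (sym (i≡x tt)) px
... | false | _   = pω i

tailᶜ : Ctx → Ctx
tailᶜ ρ i = ρ (suc i)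

mutual
  subst-⊩-inv : ∀ {ρ T} (σ : ℕ → Λ) M → ρ ⊩ subst σ M ⦂ T
              → ∃[ ρ₀ ] (ρ₀ ⊩ M ⦂ T) × (ρ ⊩ₛ σ ⦂ ρ₀)
  subst-⊩-inv {ρ} {T} σ (var x) d =
      point x ⌜ T ⌝
    , ⊩var (≡subst (_≤ᶜ T) (sym (point-self x ⌜ T ⌝)) (≤ᶜ⌜⌝ (≤ᵀ-refl T)))
    , point-elim x ⌜ T ⌝ (λ j W → ρ ⊩ σ j ⦂ᵁ W) (⊩⌜⌝ d) (λ _ → ⊩ω)
  subst-⊩-inv {ρ} σ (lam M) (⊩lam {U = U} d) with subst-⊩-inv (exts σ) M d
  ... | ρ₁ , d₁ , h₁ =
      tailᶜ ρ₁
    , ⊩lam (narrow head d₁)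
    , λ j → rename-⊩ᵁ-inv suc (σ j) (λ i → ≤ᵁ-refl (ρ i)) (h₁ (suc j))
    where
    head : (U ∷ᶜ tailᶜ ρ₁) ≤ᶜᵗˣ ρ₁
    head zero    = var-⊩ᵁ-inv (h₁ zero)
    head (suc i) = ≤ᵁ-refl (ρ₁ (suc i))
  subst-⊩-inv σ (app M N) (⊩app d e) with subst-⊩-inv σ M d | subst-⊩ᵁ-inv σ N e
  ... | ρ₁ , d₁ , h₁ | ρ₂ , e₂ , h₂ =
      ρ₁ ⊓ᶜ ρ₂
    , ⊩app (narrow (⊓ᶜ-≤ˡ ρ₁ ρ₂) d₁) (narrowᵁ (⊓ᶜ-≤ʳ ρ₁ ρ₂) e₂)
    , λ i → ⊩⊓ (h₁ i) (h₂ i)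

  subst-⊩ᵁ-inv : ∀ {ρ U} (σ : ℕ → Λ) M → ρ ⊩ subst σ M ⦂ᵁ U
               → ∃[ ρ₀ ] (ρ₀ ⊩ M ⦂ᵁ U) × (ρ ⊩ₛ σ ⦂ ρ₀)
  subst-⊩ᵁ-inv σ M ⊩ω = ω-ctx , ⊩ω , λ _ → ⊩ω
  subst-⊩ᵁ-inv σ M (⊩⊓ a b) with subst-⊩ᵁ-inv σ M a | subst-⊩ᵁ-inv σ M b
  ... | ρ₁ , a₁ , h₁ | ρ₂ , b₂ , h₂ =
      ρ₁ ⊓ᶜ ρ₂
    , ⊩⊓ (narrowᵁ (⊓ᶜ-≤ˡ ρ₁ ρ₂) a₁) (narrowᵁ (⊓ᶜ-≤ʳ ρ₁ ρ₂) b₂)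
    , λ i → ⊩⊓ (h₁ i) (h₂ i)
  subst-⊩ᵁ-inv σ M (⊩⌜⌝ d) with subst-⊩-inv σ M d
  ... | ρ₁ , d₁ , h₁ = ρ₁ , ⊩⌜⌝ d₁ , h₁

sub0-⊩ₛ : ∀ {ρ N U} → ρ ⊩ N ⦂ᵁ U → ρ ⊩ₛ sub0 N ⦂ (U ∷ᶜ ρ)
sub0-⊩ₛ e zero          = e
sub0-⊩ₛ {ρ} e (suc i)   = var-⊩ᵁ (≤ᵁ-refl (ρ i))

mutual
  ⊩-reduce : ∀ {ρ M N T} → ρ ⊩ M ⦂ T → M ▷β N → ρ ⊩ N ⦂ T
  ⊩-reduce (⊩app (⊩lam d) e) β-rule = subst-⊩ _ (sub0-⊩ₛ e) d
  ⊩-reduce (⊩lam d)   (β-lam s)     = ⊩lam (⊩-reduce d s)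
  ⊩-reduce (⊩app d e) (β-appl s)    = ⊩app (⊩-reduce d s) e
  ⊩-reduce (⊩app d e) (β-appr s)    = ⊩app d (⊩ᵁ-reduce e s)

  ⊩ᵁ-reduce : ∀ {ρ M N U} → ρ ⊩ M ⦂ᵁ U → M ▷β N → ρ ⊩ N ⦂ᵁ U
  ⊩ᵁ-reduce ⊩ω       s = ⊩ω
  ⊩ᵁ-reduce (⊩⊓ a b) s = ⊩⊓ (⊩ᵁ-reduce a s) (⊩ᵁ-reduce b s)
  ⊩ᵁ-reduce (⊩⌜⌝ d)  s = ⊩⌜⌝ (⊩-reduce d s)

-- Subject expansion for one β-step; the redex case is inverse substitution.
mutual
  ⊩-expand : ∀ {ρ M N T} → ρ ⊩ N ⦂ T → M ▷β N → ρ ⊩ M ⦂ T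
  ⊩-expand {ρ} d (β-rule {M = P} {N = Q}) with subst-⊩-inv (sub0 Q) P d
  ... | ρ₀ , d₀ , h₀ = ⊩app (⊩lam (narrow split d₀)) (h₀ zero)
    where
    split : (ρ₀ zero ∷ᶜ ρ) ≤ᶜᵗˣ ρ₀
    split zero    = ≤ᵁ-refl (ρ₀ zero)
    split (suc i) = var-⊩ᵁ-inv (h₀ (suc i))
  ⊩-expand (⊩lam d)   (β-lam s)  = ⊩lam (⊩-expand d s)
  ⊩-expand (⊩app d e) (β-appl s) = ⊩app (⊩-expand d s) e
  ⊩-expand (⊩app d e) (β-appr s) = ⊩app d (⊩ᵁ-expand e s)

  ⊩ᵁ-expand : ∀ {ρ M N U} → ρ ⊩ N ⦂ᵁ U → M ▷β N → ρ ⊩ M ⦂ᵁ U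
  ⊩ᵁ-expand ⊩ω       s = ⊩ω
  ⊩ᵁ-expand (⊩⊓ a b) s = ⊩⊓ (⊩ᵁ-expand a s) (⊩ᵁ-expand b s)
  ⊩ᵁ-expand (⊩⌜⌝ d)  s = ⊩⌜⌝ (⊩-expand d s)

⊩ᵁ-reduce* : ∀ {ρ M N U} → ρ ⊩ M ⦂ᵁ U → M ▷β* N → ρ ⊩ N ⦂ᵁ U
⊩ᵁ-reduce* a ε        = a
⊩ᵁ-reduce* a (s ◅ ss) = ⊩ᵁ-reduce* (⊩ᵁ-reduce a s) ss

⊩ᵁ-expand* : ∀ {ρ M N U} → ρ ⊩ N ⦂ᵁ U → M ▷β* N → ρ ⊩ M ⦂ᵁ U
⊩ᵁ-expand* a ε        = a
⊩ᵁ-expand* a (s ◅ ss) = ⊩ᵁ-expand (⊩ᵁ-expand* a ss) s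

▷f⇒▷β : ∀ {M N} → M ▷f N → M ▷β N
▷f⇒▷β f-rule     = β-rule
▷f⇒▷β (f-appl s) = β-appl (▷f⇒▷β s)

▷f⇒▷[_] : ∀ r {M N} → M ▷f N → M ▷[ r ] N
▷f⇒▷[ f ] s = s
▷f⇒▷[ β ] s = ▷f⇒▷β s

▷[_]*⇒▷β* : ∀ r {M N} → M ▷[ r ]* N → M ▷β* N
▷[ r ]*⇒▷β* ε        = ε
▷[ r ]*⇒▷β* (s ◅ ss) = step r s ◅ ▷[ r ]*⇒▷β* ss
  where
  step : ∀ r {M N} → M ▷[ r ] N → M ▷β N
  step f s = ▷f⇒▷β s
  step β s = s

module Soundness {r : Red} (𝓘 : Interp r) where

  mutual
    ≤ᵁ-sound : ∀ {U V M} → U ≤ᵁ V → ⟦ U ⟧𝕌 𝓘 M → ⟦ V ⟧𝕌 𝓘 M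
    ≤ᵁ-sound ≤ω       m = tt
    ≤ᵁ-sound (≤⊓ p q) m = ≤ᵁ-sound p m , ≤ᵁ-sound q m
    ≤ᵁ-sound (≤⌜⌝ p)  m = ≤ᶜ-sound p m

    ≤ᶜ-sound : ∀ {U T M} → U ≤ᶜ T → ⟦ U ⟧𝕌 𝓘 M → ⟦ T ⟧𝕋 𝓘 M
    ≤ᶜ-sound (≤ᶜˡ p)  (m , _) = ≤ᶜ-sound p m
    ≤ᶜ-sound (≤ᶜʳ p)  (_ , m) = ≤ᶜ-sound p m
    ≤ᶜ-sound (≤ᶜ⌜⌝ t) m       = ≤ᵀ-sound t m

    ≤ᵀ-sound : ∀ {T T' M} → T ≤ᵀ T' → ⟦ T ⟧𝕋 𝓘 M → ⟦ T' ⟧𝕋 𝓘 M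
    ≤ᵀ-sound ≤atom    m = m
    ≤ᵀ-sound (≤⇒ p t) m = λ N n → ≤ᵀ-sound t (m N (≤ᵁ-sound p n))

  -- Every ⟦T⟧ is closed under weak head expansion: atoms because
  -- interpretations are saturated, arrows because ▷f is closed under
  -- application to an argument.
  head-expand : ∀ T {M N} → M ▷f N → ⟦ T ⟧𝕋 𝓘 N → ⟦ T ⟧𝕋 𝓘 M
  head-expand (atom a) {M} {N} s m = Interp.sat 𝓘 a M N (▷f⇒▷[ r ] s ◅ ε) m
  head-expand (U ⇒ T) s m          = λ P p → head-expand T (f-appl s) (m P p)

  mutual
    ⊩-sound : ∀ {ρ M T} → ρ ⊩ M ⦂ T → (σ : ℕ → Λ) → (∀ i → ⟦ ρ i ⟧𝕌 𝓘 (σ i))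
            → ⟦ T ⟧𝕋 𝓘 (subst σ M)
    ⊩-sound (⊩var p) σ h = ≤ᶜ-sound p (h _)
    ⊩-sound {ρ} (⊩lam {M = M} {U = U} {T = T} d) σ h N n =
      head-expand T f-rule
        (≡subst (⟦ T ⟧𝕋 𝓘) (sym (subst-exts-[] σ N M)) (⊩-sound d (N ∷ₛ σ) h'))
      where
      h' : ∀ i → ⟦ (U ∷ᶜ ρ) i ⟧𝕌 𝓘 ((N ∷ₛ σ) i)
      h' zero    = n
      h' (suc i) = h i
    ⊩-sound (⊩app d e) σ h = ⊩-sound d σ h _ (⊩ᵁ-sound e σ h)

    ⊩ᵁ-sound : ∀ {ρ M U} → ρ ⊩ M ⦂ᵁ U → (σ : ℕ → Λ) → (∀ i → ⟦ ρ i ⟧𝕌 𝓘 (σ i))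
             → ⟦ U ⟧𝕌 𝓘 (subst σ M)
    ⊩ᵁ-sound ⊩ω       σ h = tt
    ⊩ᵁ-sound (⊩⊓ a b) σ h = ⊩ᵁ-sound a σ h , ⊩ᵁ-sound b σ h
    ⊩ᵁ-sound (⊩⌜⌝ d)  σ h = ⊩-sound d σ h

⊩⇒meaning : ∀ {r U M} → ω-ctx ⊩ M ⦂ᵁ U → ([ U ] r) M
⊩⇒meaning {U = U} {M} a 𝓘 =
  ≡subst (⟦ U ⟧𝕌 𝓘) (subst-id M) (Soundness.⊩ᵁ-sound 𝓘 a var (λ _ → tt))

-- Atoms are interpreted by direct typability in a fixed context δ; this is
-- r-saturated by subject expansion.
module TermModel (r : Red) (δ : Ctx) where

  𝓘δ : Interp r
  𝓘δ = record
    { I   = λ a M → δ ⊩ M ⦂ atom a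
    ; sat = λ a M N ss d → ⊩⌜⌝-inv (⊩ᵁ-expand* (⊩⌜⌝ d) (▷[ r ]*⇒▷β* ss)) }

  Available : 𝕌 → Set
  Available U = ∃[ x ] δ x ≡ U

  mutual
    Coveredᵁ : 𝕌 → Set
    Coveredᵁ ω       = ⊤
    Coveredᵁ (U ⊓ V) = Coveredᵁ U × Coveredᵁ V
    Coveredᵁ ⌜ T ⌝   = Coveredᵀ T

    Coveredᵀ : 𝕋 → Set
    Coveredᵀ (atom a) = ⊤
    Coveredᵀ (U ⇒ T)  = Available U × Coveredᵁ U × Coveredᵀ T

  -- For covered types, membership in the term model is direct typability.
  -- reflect is the easy direction; reify tests a function by applying it to
  -- a variable carrying its domain type.
  mutual
    reflectᵁ : ∀ U {M} → Coveredᵁ U → δ ⊩ M ⦂ᵁ U → ⟦ U ⟧𝕌 𝓘δ M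
    reflectᵁ ω       _       _         = tt
    reflectᵁ (U ⊓ V) (c , c') (⊩⊓ a b) = reflectᵁ U c a , reflectᵁ V c' b
    reflectᵁ ⌜ T ⌝   c       (⊩⌜⌝ d)   = reflectᵀ T c d

    reflectᵀ : ∀ T {M} → Coveredᵀ T → δ ⊩ M ⦂ T → ⟦ T ⟧𝕋 𝓘δ M
    reflectᵀ (atom a) _              d     = d
    reflectᵀ (U ⇒ T)  (_ , cU , cT) d N n = reflectᵀ T cT (⊩app d (reifyᵁ U cU n))

    reifyᵁ : ∀ U {M} → Coveredᵁ U → ⟦ U ⟧𝕌 𝓘δ M → δ ⊩ M ⦂ᵁ U
    reifyᵁ ω       _        _        = ⊩ω
    reifyᵁ (U ⊓ V) (c , c') (m , m') = ⊩⊓ (reifyᵁ U c m) (reifyᵁ V c' m')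
    reifyᵁ ⌜ T ⌝   c        m        = ⊩⌜⌝ (reifyᵀ T c m)

    reifyᵀ : ∀ T {M} → Coveredᵀ T → ⟦ T ⟧𝕋 𝓘δ M → δ ⊩ M ⦂ T
    reifyᵀ (atom a) _ m = m
    reifyᵀ (U ⇒ T) ((x , δx≡U) , cU , cT) m =
      app-var-inv (≡⇒≤ᵁ (sym δx≡U))
        (reifyᵀ T cT (m (var x) (reflectᵁ U cU (var-⊩ᵁ (≡⇒≤ᵁ δx≡U)))))

-- The n-th element of a list, ω past its end.
nth : List 𝕌 → ℕ → 𝕌
nth []      _       = ω
nth (U ∷ L) zero    = U
nth (U ∷ L) (suc j) = nth L j

nth-∈ : ∀ {V L} → V ∈ L → ∃[ j ] nth L j ≡ V
nth-∈ (here refl) = zero , refl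
nth-∈ (there p) with nth-∈ p
... | j , eq = suc j , eq

padω : ℕ → Ctx → Ctx
padω zero    g = g
padω (suc k) g = ω ∷ᶜ padω k g

padω-beyond : ∀ k g j → padω k g (k + j) ≡ g j
padω-beyond zero    g j = refl
padω-beyond (suc k) g j = padω-beyond k g j

padω-below : ∀ k g i → i < k → padω k g i ≡ ω
padω-below (suc k) g zero    _       = refl
padω-below (suc k) g (suc i) (s≤s p) = padω-below k g i p

mutual
  domainsᵁ : 𝕌 → List 𝕌
  domainsᵁ ω       = []
  domainsᵁ (U ⊓ V) = domainsᵁ U ++ domainsᵁ V
  domainsᵁ ⌜ T ⌝   = domainsᵀ T

  domainsᵀ : 𝕋 → List 𝕌
  domainsᵀ (atom a) = []
  domainsᵀ (U ⇒ T)  = U ∷ (domainsᵁ U ++ domainsᵀ T)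

module Coverage (r : Red) (k : ℕ) (L : List 𝕌) where
  open TermModel r (padω k (nth L))

  available : ∀ {V} → V ∈ L → Available V
  available p with nth-∈ p
  ... | j , eq = k + j , trans (padω-beyond k (nth L) j) eq

  mutual
    coveredᵁ : ∀ U → (∀ {V} → V ∈ domainsᵁ U → V ∈ L) → Coveredᵁ U
    coveredᵁ ω       _ = tt
    coveredᵁ (U ⊓ V) h = coveredᵁ U (h ∘ ∈-++⁺ˡ) , coveredᵁ V (h ∘ ∈-++⁺ʳ (domainsᵁ U))
    coveredᵁ ⌜ T ⌝   h = coveredᵀ T h

    coveredᵀ : ∀ T → (∀ {V} → V ∈ domainsᵀ T → V ∈ L) → Coveredᵀ T
    coveredᵀ (atom a) _ = tt
    coveredᵀ (U ⇒ T)  h = available (h (here refl))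
                        , coveredᵁ U (h ∘ there ∘ ∈-++⁺ˡ)
                        , coveredᵀ T (h ∘ there ∘ ∈-++⁺ʳ (domainsᵁ U))

-- Completeness: reify in the term model whose context is ω on the free
-- variables of M and carries the domain types of U beyond them, then
-- transfer the typing to the all-ω context.
meaning⇒⊩ : ∀ {r U M} → ([ U ] r) M → ω-ctx ⊩ M ⦂ᵁ U
meaning⇒⊩ {r} {U} {M} m = transferᵁ fv-ω (reifyᵁ U covered (m 𝓘δ))
  where
  δ = padω (fvBound M) (nth (domainsᵁ U))
  open TermModel r δ
  covered : Coveredᵁ U
  covered = Coverage.coveredᵁ r (fvBound M) (domainsᵁ U) U (λ p → p)
  fv-ω : ∀ i → i < fvBound M → ω ≤ᵁ δ i
  fv-ω i p = ≡⇒≤ᵁ (sym (padω-below (fvBound M) (nth (domainsᵁ U)) i p))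

meaning⇔⊩ : ∀ {r U M} → ([ U ] r) M ⇔ (ω-ctx ⊩ M ⦂ᵁ U)
meaning⇔⊩ = mk⇔ meaning⇒⊩ ⊩⇒meaning

-- Restrict a context to the free variables of M; restrict ω-ctx M is
-- definitionally envω M.
restrict : Ctx → Λ → Env
restrict ρ M i = if occurs i M then just (ρ i) else nothing

⊑ₘ-refl : ∀ m → m ⊑ₘ m
⊑ₘ-refl (just U) = some ⊑-refl
⊑ₘ-refl nothing  = none

official⇒⊩ : ∀ {M Γ U} → M ∶⟨ Γ ⊢ U ⟩ → totalize Γ ⊩ M ⦂ᵁ U
official⇒⊩ (ax {x} {T}) =
  ⊩⌜⌝ (⊩var (≡subst (_≤ᶜ T) (sym (point-self x ⌜ T ⌝)) (≤ᶜ⌜⌝ (≤ᵀ-refl T))))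
official⇒⊩ ω-r = ⊩ω
official⇒⊩ (→i {Γ = Γ} {U = U} d) = ⊩⌜⌝ (⊩lam (⊩⌜⌝-inv (narrowᵁ bind (official⇒⊩ d))))
  where
  bind : (U ∷ᶜ totalize Γ) ≤ᶜᵗˣ totalize (just U ∷ₑ Γ)
  bind zero    = ≤ᵁ-refl U
  bind (suc i) = ≤ᵁ-refl (totalize Γ i)
official⇒⊩ (→i' {Γ = Γ} d) = ⊩⌜⌝ (⊩lam (⊩⌜⌝-inv (narrowᵁ bind (official⇒⊩ d))))
  where
  bind : (ω ∷ᶜ totalize Γ) ≤ᶜᵗˣ totalize (nothing ∷ₑ Γ)
  bind zero    = ≤ω
  bind (suc i) = ≤ᵁ-refl (totalize Γ i)
official⇒⊩ (→e {Γ₁ = Γ₁} {Γ₂ = Γ₂} d e) =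
  ⊩⌜⌝ (⊩app (⊩⌜⌝-inv (narrowᵁ left (official⇒⊩ d))) (narrowᵁ right (official⇒⊩ e)))
  where
  left : totalize (Γ₁ ⊓ₑ Γ₂) ≤ᶜᵗˣ totalize Γ₁
  left i with Γ₁ i | Γ₂ i
  ... | just U  | just V  = ≤ᵁ-⊓ˡ (≤ᵁ-refl U)
  ... | just U  | nothing = ≤ᵁ-refl U
  ... | nothing | _       = ≤ω
  right : totalize (Γ₁ ⊓ₑ Γ₂) ≤ᶜᵗˣ totalize Γ₂
  right i with Γ₁ i | Γ₂ i
  ... | just U  | just V  = ≤ᵁ-⊓ʳ (≤ᵁ-refl V)
  ... | nothing | just V  = ≤ᵁ-refl V
  ... | _       | nothing = ≤ω
official⇒⊩ (⊓i a b) = ⊩⊓ (official⇒⊩ a) (official⇒⊩ b)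
official⇒⊩ (⊑r {Γ = Γ} {Γ' = Γ'} d U⊑U' Γ'⊑Γ) =
  narrowᵁ env (subsumeᵁ (official⇒⊩ d) (⊑⇒≤ᵁ U⊑U'))
  where
  env : totalize Γ' ≤ᶜᵗˣ totalize Γ
  env i with Γ' i | Γ i | Γ'⊑Γ i
  ... | _ | _ | none   = ≤ω
  ... | _ | _ | some s = ⊑⇒≤ᵁ s

mutual
  ⊩⇒official : ∀ {ρ M T} → ρ ⊩ M ⦂ T → M ∶⟨ restrict ρ M ⊢ ⌜ T ⌝ ⟩
  ⊩⇒official {ρ} (⊩var {x = x} {T = T} p) = ⊑r ax ⊑-refl env
    where
    env : restrict ρ (var x) ⊑ₑ single x ⌜ T ⌝
    env i with i ≡ᵇ x | ≡ᵇ⇒≡ i x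
    ... | true  | i≡x = some (≤ᵁ⇒⊑ (≤⌜⌝ (≡subst (_≤ᶜ T) (cong ρ (sym (i≡x tt))) p)))
    ... | false | _   = none
  ⊩⇒official {ρ} (⊩lam {M = M} {U = U} {T = T} d) with occurs 0 M in occ
  ... | true = →i (⊑r (⊩⇒official d) ⊑-refl env)
    where
    env : (just U ∷ₑ restrict ρ (lam M)) ⊑ₑ restrict (U ∷ᶜ ρ) M
    env zero rewrite occ = some ⊑-refl
    env (suc i) = ⊑ₘ-refl _
  ... | false = ⊑r (→i' (⊑r (⊩⇒official d) ⊑-refl env)) (⊑-⇒ ⊑-ω ⊑-refl) (λ _ → ⊑ₘ-refl _)
    where
    env : (nothing ∷ₑ restrict ρ (lam M)) ⊑ₑ restrict (U ∷ᶜ ρ) M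
    env zero rewrite occ = none
    env (suc i) = ⊑ₘ-refl _
  ⊩⇒official {ρ} (⊩app {M = M} {N = N} d e) = ⊑r (→e (⊩⇒official d) (⊩ᵁ⇒official e)) ⊑-refl env
    where
    env : restrict ρ (app M N) ⊑ₑ (restrict ρ M ⊓ₑ restrict ρ N)
    env i with occurs i M | occurs i N
    ... | true  | true  = some (⊑-≈ (≈-sym ≈-idem))
    ... | true  | false = some ⊑-refl
    ... | false | true  = some ⊑-refl
    ... | false | false = none

  ⊩ᵁ⇒official : ∀ {ρ M U} → ρ ⊩ M ⦂ᵁ U → M ∶⟨ restrict ρ M ⊢ U ⟩
  ⊩ᵁ⇒official {ρ} {M} ⊩ω = ⊑r ω-r ⊑-refl env
    where
    env : restrict ρ M ⊑ₑ envω M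
    env i with occurs i M
    ... | true  = some ⊑-ω
    ... | false = none
  ⊩ᵁ⇒official (⊩⊓ a b) = ⊓i (⊩ᵁ⇒official a) (⊩ᵁ⇒official b)
  ⊩ᵁ⇒official (⊩⌜⌝ d)  = ⊩⇒official d

official⇔⊩ : ∀ {M U} → M ∶⟨ envω M ⊢ U ⟩ ⇔ (ω-ctx ⊩ M ⦂ᵁ U)
official⇔⊩ {M} = mk⇔ (λ d → narrowᵁ envω-is-ω (official⇒⊩ d)) ⊩ᵁ⇒official
  where
  envω-is-ω : ω-ctx ≤ᶜᵗˣ totalize (envω M)
  envω-is-ω i with occurs i M
  ... | true  = ≤ω
  ... | false = ≤ω

theorem5p2 : (r : Red) (U : 𝕌) →
    (∀ M → (([ U ] r) M ⇔ (M ∶⟨ envω M ⊢ U ⟩)))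
    × (∀ M N → ([ U ] r) M → M ▷β* N → ([ U ] r) N)
    × (∀ M N → ([ U ] r) M → N ▷β* M → ([ U ] r) N)
    × (∀ M → (([ U ] r) M ⇔ ∃ (λ N → (M ▷β* N) × (N ∶⟨ envω N ⊢ U ⟩))))
theorem5p2 r U = typed , reduction-closed , expansion-closed , typed-reduct
  where
  typed : ∀ M → ([ U ] r) M ⇔ M ∶⟨ envω M ⊢ U ⟩
  typed M = ⇔-sym official⇔⊩ ⇔-∘ meaning⇔⊩ {r} {U} {M}

  reduction-closed : ∀ M N → ([ U ] r) M → M ▷β* N → ([ U ] r) N
  reduction-closed M N m s = ⊩⇒meaning {r} {U} (⊩ᵁ-reduce* (meaning⇒⊩ {r} {U} m) s)

  expansion-closed : ∀ M N → ([ U ] r) M → N ▷β* M → ([ U ] r) N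
  expansion-closed M N m s = ⊩⇒meaning {r} {U} (⊩ᵁ-expand* (meaning⇒⊩ {r} {U} m) s)

  typed-reduct : ∀ M → ([ U ] r) M ⇔ ∃ (λ N → (M ▷β* N) × (N ∶⟨ envω N ⊢ U ⟩))
  typed-reduct M = mk⇔ (λ m → M , ε , to (typed M) m)
                       (λ { (N , s , d) → expansion-closed N M (from (typed N) d) s })
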